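{- $ss(m, abab) = \Theta(m^{1/2})$, where $a,b$ are distinct letters.
   Context: Sequences are finite words over an arbitrary alphabet. Two sequences are isomorphic if one can be obtained from the other by a bijective renaming of letters. A sequence $u$ is $v$-free if no subsequence of $u$ is isomorphic to $v$. For sequences $u, v$, $LSS(u,v)$ is the maximum length of a $v$-free subsequence of $u$, and $ss(m,v)$ is the minimum of $LSS(u,v)$ over all sequences $u$ of length $m$. -}

module Defs where

open import Data.Nat using (ℕ; _≤_)
open import Data.List using (List; []; _∷_; map; length)
open import Data.List.Relation.Binary.Sublist.Propositional using (_⊆_)
open import Data.Product using (Σ; _×_; ∃; ∃-syntax)
open import Relation.Binary.PropositionalEquality using (_≡_)
open import Relation.Nullary using (¬_)
open import Function.Definitions using (Injective)

Seq : Set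
Seq = List ℕ

-- v ≅ w : w is obtained from v by a bijective renaming of letters.
-- (An injective renaming ℕ → ℕ restricts to a bijection between the
-- letters of v and the letters of w = map f v.)
Isomorphic : Seq → Seq → Set
Isomorphic v w = Σ (ℕ → ℕ) λ f → Injective _≡_ _≡_ f × map f v ≡ w

Free : Seq → Seq → Set
Free v u = ∀ w → w ⊆ u → ¬ Isomorphic v w

IsLSS : Seq → Seq → ℕ → Set
IsLSS u v k =
  (∃[ w ] (w ⊆ u × Free v w × length w ≡ k)) ×
  (∀ w → w ⊆ u → Free v w → length w ≤ k)

IsSS : ℕ → Seq → ℕ → Set
IsSS m v s =
  (∃[ u ] (length u ≡ m × IsLSS u v s)) ×
  (∀ u k → length u ≡ m → IsLSS u v k → s ≤ k)

abab : Seq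
abab = 0 ∷ 1 ∷ 0 ∷ 1 ∷ []

-- Lower bound: taking each letter of u once gives an abab-free subsequence, and so does
-- taking all copies of one letter; as |u| ≤ (number of letters) · (largest multiplicity),
-- LSS(u)² ≥ |u|.
-- Upper bound: build an abab-free w over letters below n from the right. When a is put in
-- front of b ∷ w′, either a does not occur in b ∷ w′, or a = b (a weak descent), or a occurs
-- in w′; then b becomes enclosed in a b a, which it was not before, as an enclosing y b y
-- inside w′ would give b y b y. So |w| ≤ 2n + (weak descents of w). Subsequences of t
-- rounds of 0, 1, …, t − 1 have at most t weak descents, hence LSS ≤ 3t for the prefix of
-- length m ≤ t² of these rounds, and t = ⌊√m⌋ + 1 gives ss(m, abab) = O(√m).
-- The minimum ss(m, abab) exists because LSS is invariant under injective renamings, so it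
-- may be taken over the finitely many sequences of length m over {0, …, m − 1}.
module Submission where

open import Defs
open import Data.Nat using (ℕ; zero; suc; _+_; _*_; _≤_; _<_; z≤n; s≤s; s≤s⁻¹; _≟_; _≤?_)
open import Data.Nat.Properties
open import Data.Nat.Tactic.RingSolver using (solve-∀)
open import Data.Fin using (toℕ)
open import Data.Fin.Properties using (toℕ<n; toℕ-injective)
open import Data.List as List
  using (List; []; _∷_; [_]; map; length; _++_; take; replicate; concat; filter; upTo; applyUpTo;
         cartesianProductWith)
open import Data.List.Properties using (length-map; length-++; length-replicate; length-upTo; length-take)
open import Data.List.Relation.Unary.Any as Any using (here; there; any?; satisfied)
open import Data.List.Relation.Unary.Any.Properties using (lookup-index)
open import Data.List.Relation.Unary.All as All using (All; []; _∷_)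
open import Data.List.Relation.Unary.All.Properties
  using (all-filter; concat⁺; replicate⁺; applyUpTo⁺₁) renaming (map⁺ to All-map⁺)
open import Data.List.Relation.Unary.AllPairs using ([]; _∷_)
open import Data.List.Relation.Unary.Unique.Propositional using (Unique)
open import Data.List.Relation.Binary.Pointwise using (Pointwise; []; _∷_)
open import Data.List.Relation.Binary.Pointwise.Properties using (Pointwise-length)
open import Data.List.Membership.Propositional using (_∈_; lose)
open import Data.List.Membership.Propositional.Properties
  using (∈-map⁺; ∈-++⁺ˡ; ∈-++⁺ʳ; ∈-++⁻; map∷⁻; ∈-cartesianProductWith⁺; ∈-cartesianProductWith⁻;
         ∈-upTo⁺; ∈-filter⁺; ∈-filter⁻)
open import Data.List.Membership.DecPropositional _≟_ using (_∈?_)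
open import Data.List.Relation.Binary.Sublist.Propositional
  using (_⊆_; []; _∷_; _∷ʳ_; lookup; minimum; from∈; ⊆-trans)
open import Data.List.Relation.Binary.Sublist.Propositional.Properties
  using (map⁺; filter-⊆; take-⊆; All-resp-⊆)
open import Data.List.Relation.Binary.Sublist.DecPropositional _≟_ using (_⊆?_)
open import Data.List.Extrema.Nat
  using (argmax; argmin; argmax-all; argmin-all; f[xs]≤f[argmax]; f[argmin]≤f[xs])
open import Data.Product using (_×_; _,_; proj₁; proj₂; ∃; ∃-syntax)
open import Data.Sum using (inj₁; inj₂)
open import Function using (id; _∘_)
open import Function.Definitions using (Injective)
open import Relation.Nullary using (¬_; Dec; yes; no; ¬?; contradiction)
open import Relation.Nullary.Decidable using (map′; _×-dec_)
open import Relation.Unary using (Decidable)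
open import Relation.Binary.PropositionalEquality
  using (_≡_; _≢_; refl; sym; trans; cong; cong₂; subst; subst₂)

module _ {a} {A : Set a} where

  sublists : List A → List (List A)
  sublists []       = [ [] ]
  sublists (x ∷ xs) = map (x ∷_) (sublists xs) ++ sublists xs

  ∈-sublists⁺ : ∀ {xs ys : List A} → xs ⊆ ys → xs ∈ sublists ys
  ∈-sublists⁺ []         = here refl
  ∈-sublists⁺ (y ∷ʳ τ)   = ∈-++⁺ʳ _ (∈-sublists⁺ τ)
  ∈-sublists⁺ (refl ∷ τ) = ∈-++⁺ˡ (∈-map⁺ (_ ∷_) (∈-sublists⁺ τ))

  ∈-sublists⁻ : ∀ {xs} ys → xs ∈ sublists ys → xs ⊆ ys
  ∈-sublists⁻ []       (here refl) = []
  ∈-sublists⁻ (y ∷ ys) p with ∈-++⁻ (map (y ∷_) (sublists ys)) p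
  ... | inj₂ q = y ∷ʳ ∈-sublists⁻ ys q
  ... | inj₁ q with _ , r , refl ← map∷⁻ q = refl ∷ ∈-sublists⁻ ys r

  ∃?-within : ∀ {p} {P : A → Set p} xs → (∀ {y} → P y → y ∈ xs) → Decidable P → Dec (∃ P)
  ∃?-within xs witness∈ P? = map′ satisfied (λ (y , py) → lose (witness∈ py) py) (any? P? xs)

  length-filter-split : ∀ {p} {P : A → Set p} (P? : Decidable P) xs →
                        length (filter P? xs) + length (filter (¬? ∘ P?) xs) ≡ length xs
  length-filter-split P? []       = refl
  length-filter-split P? (x ∷ xs) with P? x
  ... | yes _ = cong suc (length-filter-split P? xs)
  ... | no  _ = trans (+-suc _ _) (cong suc (length-filter-split P? xs))

  length-concat-replicate : ∀ {xs : List A} k → length (concat (replicate k xs)) ≡ k * length xs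
  length-concat-replicate      zero    = refl
  length-concat-replicate {xs} (suc k) =
    trans (length-++ xs) (cong (length xs +_) (length-concat-replicate k))

module _ {a b} {A : Set a} {B : Set b} (g : A → B) where

  ⊆-map⁻ : ∀ {ys} xs → ys ⊆ map g xs → ∃[ zs ] zs ⊆ xs × Pointwise (λ z y → g z ≡ y) zs ys
  ⊆-map⁻ []       []         = [] , [] , []
  ⊆-map⁻ (x ∷ xs) (_ ∷ʳ τ)   with zs , σ , gzs ← ⊆-map⁻ xs τ = zs , x ∷ʳ σ , gzs
  ⊆-map⁻ (x ∷ xs) (refl ∷ τ) with zs , σ , gzs ← ⊆-map⁻ xs τ = x ∷ zs , refl ∷ σ , refl ∷ gzs

  graph⇒map : ∀ {zs ys} → Pointwise (λ z y → g z ≡ y) zs ys → map g zs ≡ ys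
  graph⇒map []           = refl
  graph⇒map (refl ∷ gzs) = cong (_ ∷_) (graph⇒map gzs)

words : ℕ → ℕ → List (List ℕ)
words b zero    = [ [] ]
words b (suc m) = cartesianProductWith _∷_ (upTo b) (words b m)

∈-words⁺ : ∀ {b} xs → All (_< b) xs → xs ∈ words b (length xs)
∈-words⁺ []       []           = here refl
∈-words⁺ (x ∷ xs) (x<b ∷ xs<b) = ∈-cartesianProductWith⁺ _∷_ (∈-upTo⁺ x<b) (∈-words⁺ xs xs<b)

length-∈-words : ∀ b m {xs} → xs ∈ words b m → length xs ≡ m
length-∈-words b zero    (here refl) = refl
length-∈-words b (suc m) p
  with _ , _ , _ , q , refl ← ∈-cartesianProductWith⁻ _∷_ (upTo b) (words b m) p
  = cong suc (length-∈-words b m q)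

indicator : ∀ {p} {P : Set p} → Dec P → ℕ
indicator (yes _) = 1
indicator (no  _) = 0

module _ {p} {P : Set p} where

  indicator≤1 : (d : Dec P) → indicator d ≤ 1
  indicator≤1 (yes _) = ≤-refl
  indicator≤1 (no  _) = z≤n

  indicator-yes : (d : Dec P) → P → 1 ≤ indicator d
  indicator-yes (yes _)  _ = ≤-refl
  indicator-yes (no  ¬p) p = contradiction p ¬p

  indicator-no : (d : Dec P) → ¬ P → indicator d ≡ 0
  indicator-no (yes p) ¬p = contradiction p ¬p
  indicator-no (no  _) _  = refl

module _ {p q} {P : Set p} {Q : Set q} where

  indicator-mono : (d : Dec P) (e : Dec Q) → (P → Q) → indicator d ≤ indicator e
  indicator-mono (yes p) e P⇒Q = indicator-yes e (P⇒Q p)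
  indicator-mono (no  _) _ _   = z≤n

  indicator-mono-< : (d : Dec P) (e : Dec Q) → ¬ P → Q → indicator d < indicator e
  indicator-mono-< (yes p) _ ¬p _ = contradiction p ¬p
  indicator-mono-< (no  _) e _  q = indicator-yes e q

countBelow : ∀ {p} {P : ℕ → Set p} → Decidable P → ℕ → ℕ
countBelow P? zero    = 0
countBelow P? (suc n) = indicator (P? n) + countBelow P? n

countBelow≤ : ∀ {p} {P : ℕ → Set p} (P? : Decidable P) n → countBelow P? n ≤ n
countBelow≤ P? zero    = z≤n
countBelow≤ P? (suc n) = +-mono-≤ (indicator≤1 (P? n)) (countBelow≤ P? n)

module _ {p q} {P : ℕ → Set p} {Q : ℕ → Set q} (P? : Decidable P) (Q? : Decidable Q) where

  countBelow-mono : ∀ n → (∀ {x} → P x → Q x) → countBelow P? n ≤ countBelow Q? n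
  countBelow-mono zero    P⇒Q = z≤n
  countBelow-mono (suc n) P⇒Q = +-mono-≤ (indicator-mono (P? n) (Q? n) P⇒Q) (countBelow-mono n P⇒Q)

  countBelow-mono-< : ∀ {n x} → (∀ {y} → P y → Q y) → x < n → ¬ P x → Q x →
                      countBelow P? n < countBelow Q? n
  countBelow-mono-< {suc n} {x} P⇒Q x<1+n ¬px qx with x ≟ n
  ... | yes refl = +-mono-<-≤ (indicator-mono-< (P? x) (Q? x) ¬px qx) (countBelow-mono n P⇒Q)
  ... | no  x≢n  = +-mono-≤-< (indicator-mono (P? n) (Q? n) P⇒Q)
                              (countBelow-mono-< P⇒Q (≤∧≢⇒< (s≤s⁻¹ x<1+n) x≢n) ¬px qx)

ContainsABAB : List ℕ → Set
ContainsABAB w = ∃[ x ] ∃[ y ] x ≢ y × x ∷ y ∷ x ∷ y ∷ [] ⊆ w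

containsABAB? : Decidable ContainsABAB
containsABAB? w =
  ∃?-within w (λ (_ , _ , τ) → lookup τ (here refl)) λ x →
  ∃?-within w (λ (_ , τ) → lookup τ (there (here refl))) λ y →
  ¬? (x ≟ y) ×-dec (x ∷ y ∷ x ∷ y ∷ [] ⊆? w)

containsABAB-∷ : ∀ a {w} → ContainsABAB w → ContainsABAB (a ∷ w)
containsABAB-∷ a (x , y , x≢y , τ) = x , y , x≢y , a ∷ʳ τ

renaming₀₁ : ℕ → ℕ → ℕ → ℕ
renaming₀₁ x y 0             = x
renaming₀₁ x y 1             = y
renaming₀₁ x y (suc (suc n)) = suc (x + y + n)

renaming₀₁-injective : ∀ {x y} → x ≢ y → Injective _≡_ _≡_ (renaming₀₁ x y)
renaming₀₁-injective {x} {y} x≢y = injective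
  where
  x< : ∀ n → x < suc (x + y + n)
  x< n = s≤s (≤-trans (m≤m+n x y) (m≤m+n (x + y) n))
  y< : ∀ n → y < suc (x + y + n)
  y< n = s≤s (≤-trans (m≤n+m y x) (m≤m+n (x + y) n))
  injective : Injective _≡_ _≡_ (renaming₀₁ x y)
  injective {0}           {0}           _ = refl
  injective {1}           {1}           _ = refl
  injective {0}           {1}           e = contradiction e x≢y
  injective {1}           {0}           e = contradiction (sym e) x≢y
  injective {0}           {suc (suc n)} e = contradiction e (<⇒≢ (x< n))
  injective {suc (suc n)} {0}           e = contradiction (sym e) (<⇒≢ (x< n))
  injective {1}           {suc (suc n)} e = contradiction e (<⇒≢ (y< n))
  injective {suc (suc n)} {1}           e = contradiction (sym e) (<⇒≢ (y< n))
  injective {suc (suc n)} {suc (suc m)} e =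
    cong (suc ∘ suc) (+-cancelˡ-≡ (x + y) n m (suc-injective e))

free⇒¬containsABAB : ∀ {w} → Free abab w → ¬ ContainsABAB w
free⇒¬containsABAB free (x , y , x≢y , τ) =
  free _ τ (renaming₀₁ x y , renaming₀₁-injective x≢y , refl)

¬containsABAB⇒free : ∀ {w} → ¬ ContainsABAB w → Free abab w
¬containsABAB⇒free ¬abab _ τ (f , f-injective , refl) =
  ¬abab (f 0 , f 1 , (λ e → 0≢1+n (f-injective e)) , τ)

abab-free? : Decidable (Free abab)
abab-free? w = map′ ¬containsABAB⇒free free⇒¬containsABAB (¬? (containsABAB? w))

InjectiveOn : (ℕ → ℕ) → List ℕ → Set
InjectiveOn g u = ∀ {x y} → x ∈ u → y ∈ u → g x ≡ g y → x ≡ y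

module _ {g : ℕ → ℕ} {u : List ℕ} (g-injective : InjectiveOn g u) where

  containsABAB-map⁺ : ∀ {w} → w ⊆ u → ContainsABAB w → ContainsABAB (map g w)
  containsABAB-map⁺ w⊆u (x , y , x≢y , τ) =
    g x , g y , x≢y ∘ g-injective (∈u (here refl)) (∈u (there (here refl))) , map⁺ g τ
    where
    ∈u : ∀ {z} → z ∈ x ∷ y ∷ x ∷ y ∷ [] → z ∈ u
    ∈u = lookup (⊆-trans τ w⊆u)

  containsABAB-map⁻ : ∀ {w} → w ⊆ u → ContainsABAB (map g w) → ContainsABAB w
  containsABAB-map⁻ {w} w⊆u (_ , _ , gx≢gy , τ)
    with a ∷ b ∷ a′ ∷ b′ ∷ [] , σ , refl ∷ refl ∷ ga′≡ga ∷ gb′≡gb ∷ [] ← ⊆-map⁻ g w τ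
    = a , b , gx≢gy ∘ cong g , subst₂ (λ c d → a ∷ b ∷ c ∷ d ∷ [] ⊆ w) a′≡a b′≡b σ
    where
    ∈u : ∀ {z} → z ∈ a ∷ b ∷ a′ ∷ b′ ∷ [] → z ∈ u
    ∈u = lookup (⊆-trans σ w⊆u)
    a′≡a : a′ ≡ a
    a′≡a = g-injective (∈u (there (there (here refl)))) (∈u (here refl)) ga′≡ga
    b′≡b : b′ ≡ b
    b′≡b = g-injective (∈u (there (there (there (here refl))))) (∈u (there (here refl))) gb′≡gb

-- Existence of LSS and ss

IsLSS-unique : ∀ {u v k k′} → IsLSS u v k → IsLSS u v k′ → k ≡ k′
IsLSS-unique ((w , w⊆u , free , refl) , maximal) ((w′ , w′⊆u , free′ , refl) , maximal′) =
  ≤-antisym (maximal′ w w⊆u free) (maximal w′ w′⊆u free′)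

IsLSS-exists : ∀ {v} → Decidable (Free v) → Free v [] → ∀ u → ∃[ k ] IsLSS u v k
IsLSS-exists {v} v-free? []-free u =
  length w* , (w* , proj₁ w*-candidate , proj₂ w*-candidate , refl) , maximal
  where
  candidates : List Seq
  candidates = filter v-free? (sublists u)
  w* : Seq
  w* = argmax length [] candidates
  candidate : ∀ {w} → w ∈ candidates → w ⊆ u × Free v w
  candidate p with q , free ← ∈-filter⁻ v-free? p = ∈-sublists⁻ u q , free
  w*-candidate : w* ⊆ u × Free v w*
  w*-candidate = argmax-all length (minimum u , []-free) (All.tabulate candidate)
  maximal : ∀ w → w ⊆ u → Free v w → length w ≤ length w*
  maximal w w⊆u free =
    All.lookup (f[xs]≤f[argmax] [] candidates) (∈-filter⁺ v-free? (∈-sublists⁺ w⊆u) free)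

IsLSS-abab-exists : ∀ u → ∃[ k ] IsLSS u abab k
IsLSS-abab-exists = IsLSS-exists abab-free? (¬containsABAB⇒free λ { (_ , _ , _ , ()) })

IsLSS-map : ∀ {g u k} → InjectiveOn g u → IsLSS u abab k → IsLSS (map g u) abab k
IsLSS-map {g} {u} g-injective ((w , w⊆u , free , refl) , maximal) =
  (map g w , map⁺ g w⊆u , map-free , length-map g w) , maximal′
  where
  map-free : Free abab (map g w)
  map-free = ¬containsABAB⇒free (free⇒¬containsABAB free ∘ containsABAB-map⁻ g-injective w⊆u)
  maximal′ : ∀ w′ → w′ ⊆ map g u → Free abab w′ → length w′ ≤ length w
  maximal′ w′ τ free′ with zs , σ , gzs ← ⊆-map⁻ g u τ =
    subst (_≤ length w) (Pointwise-length gzs) (maximal zs σ zs-free)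
    where
    zs-free : Free abab zs
    zs-free = ¬containsABAB⇒free (free⇒¬containsABAB free′ ∘ subst ContainsABAB (graph⇒map g gzs)
                                   ∘ containsABAB-map⁺ g-injective σ)

position : List ℕ → ℕ → ℕ
position u x with x ∈? u
... | yes x∈u = toℕ (Any.index x∈u)
... | no  _   = 0

position-< : ∀ {u x} → x ∈ u → position u x < length u
position-< {u} {x} x∈u with x ∈? u
... | yes x∈u′ = toℕ<n (Any.index x∈u′)
... | no  x∉u  = contradiction x∈u x∉u

position-injectiveOn : ∀ u → InjectiveOn (position u) u
position-injectiveOn u {x} {y} x∈u y∈u eq with x ∈? u | y ∈? u
... | yes p  | yes q  =
  trans (lookup-index p) (trans (cong (List.lookup u) (toℕ-injective eq)) (sym (lookup-index q)))
... | no x∉u | _      = contradiction x∈u x∉u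
... | _      | no y∉u = contradiction y∈u y∉u

normalise : List ℕ → List ℕ
normalise u = map (position u) u

normalise-∈-words : ∀ u → normalise u ∈ words (length u) (length u)
normalise-∈-words u =
  subst (λ n → normalise u ∈ words (length u) n) (length-map (position u) u)
        (∈-words⁺ (normalise u) (All-map⁺ (All.tabulate position-<)))

IsSS-abab-exists : ∀ m → ∃[ s ] IsSS m abab s
IsSS-abab-exists m = LSS u* , (u* , length-u* , LSS-spec u*) , minimal
  where
  LSS : Seq → ℕ
  LSS u = proj₁ (IsLSS-abab-exists u)
  LSS-spec : ∀ u → IsLSS u abab (LSS u)
  LSS-spec u = proj₂ (IsLSS-abab-exists u)
  u* : Seq
  u* = argmin LSS (replicate m 0) (words m m)
  length-u* : length u* ≡ m
  length-u* = argmin-all LSS (length-replicate m) (All.tabulate (length-∈-words m m))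
  minimal : ∀ u k → length u ≡ m → IsLSS u abab k → LSS u* ≤ k
  minimal u k |u|≡m u-LSS = begin
    LSS u*            ≤⟨ All.lookup (f[argmin]≤f[xs] {f = LSS} (replicate m 0) (words m m))
                                    normalise-u∈words ⟩
    LSS (normalise u) ≡⟨ IsLSS-unique (LSS-spec (normalise u)) (IsLSS-map (position-injectiveOn u) u-LSS) ⟩
    k                 ∎
    where
    open ≤-Reasoning
    normalise-u∈words : normalise u ∈ words m m
    normalise-u∈words = subst (λ n → normalise u ∈ words n n) |u|≡m (normalise-∈-words u)

-- The lower bound

length≤distinct*multiplicity : ∀ p q u →
  (∀ w → w ⊆ u → Unique w → length w ≤ p) →
  (∀ x v → v ⊆ u → All (_≡ x) v → length v ≤ q) →
  length u ≤ p * q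
length≤distinct*multiplicity p       q []      _        _ = z≤n
length≤distinct*multiplicity zero    q (x ∷ r) distinct _
  with distinct [ x ] (refl ∷ minimum r) ([] ∷ [])
... | ()
length≤distinct*multiplicity (suc p) q (x ∷ r) distinct multiplicity = begin
  length (x ∷ r)              ≡⟨ cong suc (sym (length-filter-split (_≟ x) r)) ⟩
  length same + length others ≤⟨ +-mono-≤ (multiplicity x same same⊆u (refl ∷ all-filter (_≟ x) r))
                                           (length≤distinct*multiplicity p q others distinct′ multiplicity′) ⟩
  q + p * q                   ∎
  where
  open ≤-Reasoning
  same others : List ℕ
  same   = x ∷ filter (_≟ x) r
  others = filter (¬? ∘ (_≟ x)) r
  same⊆u : same ⊆ x ∷ r
  same⊆u = refl ∷ filter-⊆ (_≟ x) r
  others⊆r : others ⊆ r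
  others⊆r = filter-⊆ (¬? ∘ (_≟ x)) r
  distinct′ : ∀ w → w ⊆ others → Unique w → length w ≤ p
  distinct′ w w⊆others w-unique =
    s≤s⁻¹ (distinct (x ∷ w) (refl ∷ ⊆-trans w⊆others others⊆r) (x∉w ∷ w-unique))
    where
    x∉w : All (x ≢_) w
    x∉w = All.map (_∘ sym) (All-resp-⊆ w⊆others (all-filter (¬? ∘ (_≟ x)) r))
  multiplicity′ : ∀ y v → v ⊆ others → All (_≡ y) v → length v ≤ q
  multiplicity′ y v v⊆others = multiplicity y v (x ∷ʳ ⊆-trans v⊆others others⊆r)

unique⇒¬xx⊆ : ∀ {x : ℕ} {w} → Unique w → ¬ (x ∷ x ∷ [] ⊆ w)
unique⇒¬xx⊆ (_   ∷ w-unique) (_ ∷ʳ τ)   = unique⇒¬xx⊆ w-unique τ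
unique⇒¬xx⊆ (x∉w ∷ _)        (refl ∷ τ) = All.lookup x∉w (lookup τ (here refl)) refl

unique⇒¬containsABAB : ∀ {w : List ℕ} → Unique w → ¬ ContainsABAB w
unique⇒¬containsABAB w-unique (_ , y , _ , τ) =
  unique⇒¬xx⊆ w-unique (⊆-trans (refl ∷ y ∷ʳ refl ∷ y ∷ʳ []) τ)

constant⇒¬containsABAB : ∀ {z w} → All (_≡ z) w → ¬ ContainsABAB w
constant⇒¬containsABAB w≡z (_ , _ , x≢y , τ) =
  x≢y (trans (All.lookup w≡z (lookup τ (here refl))) (sym (All.lookup w≡z (lookup τ (there (here refl))))))

length≤LSS² : ∀ {u k} → IsLSS u abab k → length u ≤ k * k
length≤LSS² {u} {k} (_ , maximal) = length≤distinct*multiplicity k k u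
  (λ w w⊆u w-unique → maximal w w⊆u (¬containsABAB⇒free (unique⇒¬containsABAB w-unique)))
  (λ _ v v⊆u v-constant → maximal v v⊆u (¬containsABAB⇒free (constant⇒¬containsABAB v-constant)))

ss-lower : ∀ {m s} → IsSS m abab s → m ≤ s * s
ss-lower ((_ , refl , u-LSS) , _) = length≤LSS² u-LSS

-- Weak descents

descents : List ℕ → ℕ
descents []           = 0
descents (x ∷ [])     = 0
descents (x ∷ y ∷ ys) = indicator (y ≤? x) + descents (y ∷ ys)

descents-∷ : ∀ a w → descents w ≤ descents (a ∷ w)
descents-∷ a []      = z≤n
descents-∷ a (y ∷ w) = m≤n+m _ _

descents-skip : ∀ x y w → descents (x ∷ w) ≤ descents (x ∷ y ∷ w)
descents-skip x y []      = z≤n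
descents-skip x y (z ∷ w) = begin
  indicator (z ≤? x) + descents (z ∷ w)                        ≤⟨ +-monoˡ-≤ (descents (z ∷ w)) triangle ⟩
  indicator (y ≤? x) + indicator (z ≤? y) + descents (z ∷ w)   ≡⟨ +-assoc (indicator (y ≤? x)) _ _ ⟩
  indicator (y ≤? x) + (indicator (z ≤? y) + descents (z ∷ w)) ∎
  where
  open ≤-Reasoning
  triangle : indicator (z ≤? x) ≤ indicator (y ≤? x) + indicator (z ≤? y)
  triangle with z ≤? x | y ≤? x | z ≤? y
  ... | no  _   | _       | _       = z≤n
  ... | yes _   | yes _   | _       = s≤s z≤n
  ... | yes _   | no  _   | yes _   = s≤s z≤n
  ... | yes z≤x | no  y≰x | no  z≰y = contradiction (≤-trans (<⇒≤ (≰⇒> z≰y)) z≤x) y≰x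

descents-∷-mono : ∀ x {w u} → w ⊆ u → descents (x ∷ w) ≤ descents (x ∷ u)
descents-∷-mono x []                  = ≤-refl
descents-∷-mono x (_∷ʳ_ {ys = u} y τ) = ≤-trans (descents-∷-mono x τ) (descents-skip x y u)
descents-∷-mono x (refl ∷ τ)          = +-monoʳ-≤ _ (descents-∷-mono _ τ)

descents-mono : ∀ {w u} → w ⊆ u → descents w ≤ descents u
descents-mono []                  = z≤n
descents-mono (_∷ʳ_ {ys = u} y τ) = ≤-trans (descents-mono τ) (descents-∷ y u)
descents-mono (refl ∷ τ)          = descents-∷-mono _ τ

descents-++ : ∀ xs ys → descents (xs ++ ys) ≤ descents xs + suc (descents ys)
descents-++ []            ys       = n≤1+n _
descents-++ (x ∷ [])      []       = z≤n
descents-++ (x ∷ [])      (y ∷ ys) = +-monoˡ-≤ (descents (y ∷ ys)) (indicator≤1 (y ≤? x))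
descents-++ (x ∷ x′ ∷ xs) ys       = begin
  indicator (x′ ≤? x) + descents (x′ ∷ xs ++ ys)                 ≤⟨ +-monoʳ-≤ _ (descents-++ (x′ ∷ xs) ys) ⟩
  indicator (x′ ≤? x) + (descents (x′ ∷ xs) + suc (descents ys)) ≡⟨ +-assoc (indicator (x′ ≤? x)) _ _ ⟨
  indicator (x′ ≤? x) + descents (x′ ∷ xs) + suc (descents ys)   ∎
  where open ≤-Reasoning

descents-applyUpTo : ∀ {f} → (∀ i → f i < f (suc i)) → ∀ n → descents (applyUpTo f n) ≡ 0
descents-applyUpTo f↑ 0             = refl
descents-applyUpTo f↑ 1             = refl
descents-applyUpTo f↑ (suc (suc n)) =
  cong₂ _+_ (indicator-no (_ ≤? _) (<⇒≱ (f↑ 0))) (descents-applyUpTo (f↑ ∘ suc) (suc n))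

descents-concat-replicate : ∀ {xs} → descents xs ≡ 0 → ∀ k → descents (concat (replicate k xs)) ≤ k
descents-concat-replicate      _   zero    = z≤n
descents-concat-replicate {xs} xs↑ (suc k) = begin
  descents (xs ++ concat (replicate k xs))               ≤⟨ descents-++ xs _ ⟩
  descents xs + suc (descents (concat (replicate k xs))) ≤⟨ +-mono-≤ (≤-reflexive xs↑)
                                                                     (s≤s (descents-concat-replicate xs↑ k)) ⟩
  suc k                                                  ∎
  where open ≤-Reasoning

-- The upper bound

Enclosed : ℕ → List ℕ → Set
Enclosed x w = ∃[ y ] y ≢ x × y ∷ x ∷ y ∷ [] ⊆ w

enclosed? : ∀ w → Decidable (λ x → Enclosed x w)
enclosed? w x = ∃?-within w (λ (_ , τ) → lookup τ (here refl)) λ y →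
                ¬? (y ≟ x) ×-dec (y ∷ x ∷ y ∷ [] ⊆? w)

enclosed-∷ : ∀ a {x w} → Enclosed x w → Enclosed x (a ∷ w)
enclosed-∷ a (y , y≢x , τ) = y , y≢x , a ∷ʳ τ

¬enclosed-head : ∀ {b w} → ¬ ContainsABAB (b ∷ w) → ¬ Enclosed b (b ∷ w)
¬enclosed-head ¬abab (y , y≢b , _ ∷ʳ τ)   = ¬abab (_ , y , y≢b ∘ sym , refl ∷ τ)
¬enclosed-head ¬abab (y , y≢b , refl ∷ _) = y≢b refl

distinctBelow enclosedBelow potential : ℕ → List ℕ → ℕ
distinctBelow n w = countBelow (_∈? w) n
enclosedBelow n w = countBelow (enclosed? w) n
potential     n w = distinctBelow n w + enclosedBelow n w + descents w

distinctBelow-∷ : ∀ n a w → distinctBelow n w ≤ distinctBelow n (a ∷ w)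
distinctBelow-∷ n a w = countBelow-mono (_∈? w) (_∈? a ∷ w) n there

enclosedBelow-∷ : ∀ n a w → enclosedBelow n w ≤ enclosedBelow n (a ∷ w)
enclosedBelow-∷ n a w = countBelow-mono (enclosed? w) (enclosed? (a ∷ w)) n (enclosed-∷ a)

potential-∷ : ∀ n a w → ¬ ContainsABAB (a ∷ w) → All (_< n) (a ∷ w) →
              potential n w < potential n (a ∷ w)
potential-∷ n a w ¬abab (a<n ∷ _) with a ∈? w
potential-∷ n a w ¬abab (a<n ∷ _) | no a∉w =
  +-mono-<-≤ (+-mono-<-≤ new-letter (enclosedBelow-∷ n a w)) (descents-∷ a w)
  where
  new-letter : distinctBelow n w < distinctBelow n (a ∷ w)
  new-letter = countBelow-mono-< (_∈? w) (_∈? a ∷ w) there a<n a∉w (here refl)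
potential-∷ n a []      _     _             | yes ()
potential-∷ n a (b ∷ w) ¬abab (_ ∷ b<n ∷ _) | yes a∈bw with a ≟ b
... | yes refl = +-mono-≤-< (+-mono-≤ (distinctBelow-∷ n a (a ∷ w)) (enclosedBelow-∷ n a (a ∷ w))) repeat
  where
  repeat : descents (a ∷ w) < descents (a ∷ a ∷ w)
  repeat = +-monoˡ-≤ (descents (a ∷ w)) (indicator-yes (a ≤? a) ≤-refl)
... | no a≢b = +-mono-<-≤ (+-mono-≤-< (distinctBelow-∷ n a (b ∷ w)) b-enclosed) (descents-∷ a (b ∷ w))
  where
  b-enclosed : enclosedBelow n (b ∷ w) < enclosedBelow n (a ∷ b ∷ w)
  b-enclosed = countBelow-mono-< (enclosed? (b ∷ w)) (enclosed? (a ∷ b ∷ w)) (enclosed-∷ a) b<n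
                 (¬enclosed-head (¬abab ∘ containsABAB-∷ a))
                 (a , a≢b , refl ∷ refl ∷ from∈ (Any.tail a≢b a∈bw))

length≤potential : ∀ n w → ¬ ContainsABAB w → All (_< n) w → length w ≤ potential n w
length≤potential n []      _     _              = z≤n
length≤potential n (a ∷ w) ¬abab aw<n@(_ ∷ w<n) =
  ≤-trans (s≤s (length≤potential n w (¬abab ∘ containsABAB-∷ a) w<n)) (potential-∷ n a w ¬abab aw<n)

LSS≤2n+descents : ∀ {n u k} → All (_< n) u → IsLSS u abab k → k ≤ n + n + descents u
LSS≤2n+descents {n} {u} u<n ((w , w⊆u , free , refl) , _) = begin
  length w                                           ≤⟨ length≤potential n w (free⇒¬containsABAB free)
                                                                            (All-resp-⊆ w⊆u u<n) ⟩
  distinctBelow n w + enclosedBelow n w + descents w ≤⟨ +-mono-≤ (+-mono-≤ (countBelow≤ _ n) (countBelow≤ _ n))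
                                                                  (descents-mono w⊆u) ⟩
  n + n + descents u                                 ∎
  where open ≤-Reasoning

cyclic : ℕ → List ℕ
cyclic t = concat (replicate t (upTo t))

length-cyclic : ∀ t → length (cyclic t) ≡ t * t
length-cyclic t = trans (length-concat-replicate t) (cong (t *_) (length-upTo t))

cyclic-< : ∀ t → All (_< t) (cyclic t)
cyclic-< t = concat⁺ (replicate⁺ t (applyUpTo⁺₁ id t id))

descents-cyclic : ∀ t → descents (cyclic t) ≤ t
descents-cyclic t = descents-concat-replicate (descents-applyUpTo n<1+n t) t

LSS-⊆-cyclic≤ : ∀ t {u k} → u ⊆ cyclic t → IsLSS u abab k → k ≤ t + t + t
LSS-⊆-cyclic≤ t u⊆cyclic u-LSS =
  ≤-trans (LSS≤2n+descents (All-resp-⊆ u⊆cyclic (cyclic-< t)) u-LSS)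
          (+-monoʳ-≤ (t + t) (≤-trans (descents-mono u⊆cyclic) (descents-cyclic t)))

integerSqrt : ∀ m → ∃[ k ] k * k ≤ m × m < suc k * suc k
integerSqrt zero = 0 , z≤n , s≤s z≤n
integerSqrt (suc m) with k , k²≤m , m<[1+k]² ← integerSqrt m with m≤n⇒m<n∨m≡n m<[1+k]²
... | inj₁ 1+m<[1+k]² = k , m≤n⇒m≤1+n k²≤m , 1+m<[1+k]²
... | inj₂ 1+m≡[1+k]² = suc k , ≤-reflexive (sym 1+m≡[1+k]²) ,
                        subst (_< suc (suc k) * suc (suc k)) (sym 1+m≡[1+k]²)
                              (*-mono-< (n<1+n (suc k)) (n<1+n (suc k)))

-- The witness is the prefix of length m of cyclic t for t = ⌊√m⌋ + 1 ≤ 2⌊√m⌋.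
ss-upper : ∀ {m s} → 1 ≤ m → IsSS m abab s → s * s ≤ 36 * m
ss-upper {m} 1≤m _ with integerSqrt m
ss-upper {m} 1≤m _ | zero , _ , m<1 = contradiction 1≤m (<⇒≱ m<1)
ss-upper {m} {s} 1≤m (_ , minimal) | k@(suc _) , k²≤m , m<[1+k]² = begin
  s * s        ≤⟨ *-mono-≤ s≤6k s≤6k ⟩
  6k * 6k      ≡⟨ square-6k k ⟩
  36 * (k * k) ≤⟨ *-monoʳ-≤ 36 k²≤m ⟩
  36 * m       ∎
  where
  open ≤-Reasoning
  6k : ℕ
  6k = k + k + (k + k) + (k + k)
  square-6k : ∀ j → (j + j + (j + j) + (j + j)) * (j + j + (j + j) + (j + j)) ≡ 36 * (j * j)
  square-6k = solve-∀
  t : ℕ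
  t = suc k
  |prefix|≡m : length (take m (cyclic t)) ≡ m
  |prefix|≡m = trans (length-take m (cyclic t))
                     (m≤n⇒m⊓n≡m (≤-trans (<⇒≤ m<[1+k]²) (≤-reflexive (sym (length-cyclic t)))))
  t≤2k : t ≤ k + k
  t≤2k = subst (_≤ k + k) (+-comm k 1) (+-monoʳ-≤ k (s≤s z≤n))
  s≤6k : s ≤ 6k
  s≤6k with k′ , prefix-LSS ← IsLSS-abab-exists (take m (cyclic t)) = begin
    s         ≤⟨ minimal _ k′ |prefix|≡m prefix-LSS ⟩
    k′        ≤⟨ LSS-⊆-cyclic≤ t (take-⊆ m (cyclic t)) prefix-LSS ⟩
    t + t + t ≤⟨ +-mono-≤ (+-mono-≤ t≤2k t≤2k) t≤2k ⟩
    6k        ∎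

mainTheorem17 : ∃[ C ] ∃[ N ] (∀ m → N ≤ m →
                  ∃[ s ] (IsSS m abab s × (m ≤ suc C * (s * s)) × (s * s ≤ suc C * m)))
mainTheorem17 = 35 , 1 , λ m 1≤m →
  let s , s-ss = IsSS-abab-exists m
  in  s , s-ss , ≤-trans (ss-lower s-ss) (m≤n*m (s * s) 36) , ss-upper 1≤m s-ss
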